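{- Let $G$ be a uniquely distinguishing colorable graph. If $G$ is $2$-regular, then $G$ is isomorphic to $C_3$ or $C_4$.
   Context: A distinguishing $k$-coloring of a graph is a partition of its vertex set into exactly $k$ non-empty independent sets such that only the identity automorphism maps every class onto itself; $\chi_D$ is the least such $k$. A graph is uniquely distinguishing colorable if there is exactly one partition of its vertex set into $\chi_D$ classes forming a distinguishing coloring. -}

module Defs where

open import Data.Nat using (ℕ; zero; suc; _≤_; _%_; _≡ᵇ_)
open import Data.Fin using (Fin; toℕ)
open import Data.Bool using (Bool; true; false; if_then_else_; _∨_)
open import Data.List using (map; allFin)
open import Data.Nat.ListAction using (sum)
open import Data.Product using (Σ; _×_; _,_)
open import Function.Bundles using (_↔_; Inverse)
open import Function.Definitions using (Surjective)
open import Relation.Binary.PropositionalEquality using (_≡_; _≢_)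
open import Function.Bundles using (_⇔_)

record Graph : Set where
  field
    n   : ℕ
    Adj : Fin n → Fin n → Bool
open Graph public

record IsSimple (G : Graph) : Set where
  field
    loopless  : ∀ v → Adj G v v ≡ false
    symmetric : ∀ u v → Adj G u v ≡ Adj G v u
open IsSimple public

degree : (G : Graph) → Fin (n G) → ℕ
degree G u = sum (map (λ v → if Adj G u v then 1 else 0) (allFin (n G)))

Regular : ℕ → Graph → Set
Regular r G = ∀ u → degree G u ≡ r

record _≅_ (G H : Graph) : Set where
  field
    bij      : Fin (n G) ↔ Fin (n H)
    preserve : ∀ u v → Adj H (Inverse.to bij u) (Inverse.to bij v) ≡ Adj G u v

Automorphism : Graph → Set
Automorphism G = G ≅ G

-- A coloring of G with exactly k (nonempty) classes that is proper:
-- c : V → Fin k surjective, adjacent vertices get different colors.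
record Coloring (G : Graph) (k : ℕ) : Set where
  field
    col    : Fin (n G) → Fin k
    onto   : Surjective _≡_ _≡_ col
    proper : ∀ u v → Adj G u v ≡ true → col u ≢ col v
open Coloring public

Fixes : {G : Graph} {k : ℕ} → Coloring G k → Automorphism G → Set
Fixes c σ = ∀ v → col c (Inverse.to (_≅_.bij σ) v) ≡ col c v

Distinguishing : {G : Graph} {k : ℕ} → Coloring G k → Set
Distinguishing {G} c = (σ : Automorphism G) → Fixes c σ → ∀ v → Inverse.to (_≅_.bij σ) v ≡ v

HasDistColoring : Graph → ℕ → Set
HasDistColoring G k = Σ (Coloring G k) Distinguishing

IsChiD : Graph → ℕ → Set
IsChiD G k = HasDistColoring G k × (∀ j → HasDistColoring G j → k ≤ j)

SamePartition : {G : Graph} {k : ℕ} → Coloring G k → Coloring G k → Set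
SamePartition {G} c d = ∀ u v → (col c u ≡ col c v) ⇔ (col d u ≡ col d v)

UniquelyDistColorable : Graph → Set
UniquelyDistColorable G =
  Σ ℕ λ k → IsChiD G k ×
    ((c d : HasDistColoring G k) → SamePartition (Data.Product.proj₁ c) (Data.Product.proj₁ d))
  where import Data.Product

Cycle : ℕ → Graph
Cycle zero = record { n = zero ; Adj = λ () }
Cycle (suc k) = record
  { n = suc k
  ; Adj = λ i j → (toℕ j ≡ᵇ (suc (toℕ i) % suc k)) ∨ (toℕ i ≡ᵇ (suc (toℕ j) % suc k)) }

-- A 2-regular graph is a disjoint union of cycles, and rotating one cycle is an automorphism. A proper
-- 2-coloring alternates along the cycles, so the rotation squared preserves it and it is not
-- distinguishing. On n ≥ 5 vertices, merging two suitable non-adjacent vertices gives a distinguishing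
-- coloring with n - 1 colors, so the unique distinguishing χ_D-partition has a class with two vertices.
-- Uniqueness makes every automorphism permute the classes, and then a vertex in a non-singleton class
-- sees all other colors on its neighbours: otherwise recoloring it with a missing color would give a
-- second distinguishing partition. With four or more colors this is impossible. With three colors
-- there are then no singleton classes, the colors repeat with period 3 along every cycle, the rotation
-- cubed preserves the coloring and the cycles are triangles; rotating the triangle through a vertex w
-- fixes a classmate of w but moves w to a neighbour. Orders 3 and 4 are checked directly.
module Submission where

open import Defs
open import Data.Nat using (ℕ; _≥_)
open import Data.Sum using (_⊎_)

open import Data.Bool using (Bool; true; false; if_then_else_)
open import Data.Bool.Properties using (¬-not)
open import Data.Empty using (⊥; ⊥-elim)
open import Data.Fin as Fin using (Fin; zero; suc; toℕ; fromℕ<; _≟_; punchIn; punchOut)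
open import Data.Fin.Properties
  using ( <⇒notInjective; injective⇒≤; ¬∀⟶∃¬; suc-injective; pigeonhole; <⇒≢
        ; punchOut-cong; punchOut-injective; punchOut-punchIn; punchInᵢ≢i )
import Data.List as List
open import Data.List.Properties using (map-tabulate)
open import Data.Nat using (zero; suc; pred; _+_; _*_; _<_; _≤_; z≤n; s≤s; s≤s⁻¹; NonZero; >-nonZero)
open import Data.Nat.DivMod using (_%_; _/_; m≡m%n+[m/n]*n; m%n<n)
open import Data.Nat.Induction using (<-wellFounded; Acc; acc)
open import Data.Nat.ListAction using (sum)
open import Data.Nat.Properties
  using ( n<1+n; <⇒≤; <-cmp; <-irrefl; ≮⇒≥; ≤-antisym; ≤-trans; ≤-<-trans; ≤-reflexive
        ; +-comm; +-assoc; +-suc; +-identityʳ; +-commutativeSemigroup; suc-pred; pred-mono-≤; anyUpTo? )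
open import Algebra.Properties.CommutativeSemigroup +-commutativeSemigroup using (x∙yz≈y∙xz)
open import Data.Product using (∃; ∃₂; _×_; _,_; proj₁; proj₂)
open import Data.Sum using (inj₁; inj₂; [_,_])
import Data.Sum as ⊎
open import Data.Vec using (Vec; []; _∷_; lookup)
open import Data.Vec.Membership.Propositional using (_∈_; _∉_)
import Data.Vec.Membership.DecPropositional as DecMembership
open import Data.Vec.Relation.Unary.All using (All; []; _∷_)
open import Data.Vec.Relation.Unary.AllPairs using ([]; _∷_)
open import Data.Vec.Relation.Unary.Any using (here; there; index)
open import Data.Vec.Relation.Unary.Any.Properties using (lookup-index)
open import Data.Vec.Relation.Unary.Unique.Propositional using (Unique)
open import Data.Vec.Relation.Unary.Unique.Propositional.Properties using (lookup-injective)
open import Function using (id; _∘_; case_of_)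
open import Function.Bundles using (_↔_; Inverse; Equivalence; mk↔ₛ′)
open import Function.Definitions using (Surjective)
open import Function.Properties.Inverse using (↔-refl; ↔-sym; ↔-trans)
open import Relation.Binary using (tri<; tri≈; tri>)
open import Relation.Binary.PropositionalEquality
  using (_≡_; _≢_; refl; sym; trans; cong; cong₂; subst; module ≡-Reasoning)
open import Relation.Nullary using (¬_; Dec; yes; no)

open ≡-Reasoning

∉⇒All≢ : ∀ {N L} {v : Fin N} {xs : Vec (Fin N) L} → v ∉ xs → All (v ≢_) xs
∉⇒All≢ {xs = []}     v∉xs = []
∉⇒All≢ {xs = x ∷ xs} v∉xs = (v∉xs ∘ here) ∷ ∉⇒All≢ (v∉xs ∘ there)

fresh : ∀ {L N} → L < N → (xs : Vec (Fin N) L) → ∃ (_∉ xs)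
fresh {N = N} L<N xs = ¬∀⟶∃¬ N (_∈ xs) (λ v → DecMembership._∈?_ _≟_ v xs) all∈
  where
  all∈ : (∀ v → v ∈ xs) → ⊥
  all∈ h = <⇒notInjective L<N λ {u} {v} e →
    trans (lookup-index (h u)) (trans (cong (lookup xs) e) (sym (lookup-index (h v))))

unique⇒∈ : ∀ {N} {xs : Vec (Fin N) N} → Unique xs → ∀ v → v ∈ xs
unique⇒∈ {N} {xs} xs! v with DecMembership._∈?_ _≟_ v xs
... | yes v∈xs = v∈xs
... | no  v∉xs = ⊥-elim (<⇒notInjective (n<1+n N) (lookup-injective (∉⇒All≢ v∉xs ∷ xs!) _ _))

∉tail⇒≡head : ∀ {N} {a d : Fin (suc N)} {xs : Vec (Fin (suc N)) N} →
              Unique (a ∷ xs) → d ∉ xs → d ≡ a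
∉tail⇒≡head axs! d∉xs with unique⇒∈ axs! _
... | here d≡a   = d≡a
... | there d∈xs = ⊥-elim (d∉xs d∈xs)

enumeration↔ : ∀ {N} {xs : Vec (Fin N) N} → Unique xs → Fin N ↔ Fin N
enumeration↔ {xs = xs} xs! = mk↔ₛ′ (index ∘ unique⇒∈ xs!) (lookup xs)
  (λ i → lookup-injective xs! _ _ (sym (lookup-index (unique⇒∈ xs! (lookup xs i)))))
  (λ v → sym (lookup-index (unique⇒∈ xs! v)))

count : ∀ {m} → (Fin m → Bool) → ℕ
count g = sum (List.tabulate (λ i → if g i then 1 else 0))

degree≡count : (G : Graph) (u : Fin (n G)) → degree G u ≡ count (Adj G u)
degree≡count G u = cong sum (map-tabulate id (λ v → if Adj G u v then 1 else 0))

count≡0⇒false : ∀ {m} (g : Fin m → Bool) → count g ≡ 0 → ∀ w → g w ≡ false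
count≡0⇒false {suc m} g c≡0 w with g zero in g₀
count≡0⇒false {suc m} g () w       | true
count≡0⇒false {suc m} g c≡0 zero    | false = g₀
count≡0⇒false {suc m} g c≡0 (suc w) | false = count≡0⇒false (g ∘ suc) c≡0 w

count≡1⇒unique : ∀ {m} (g : Fin m → Bool) → count g ≡ 1 →
          ∃ λ a → g a ≡ true × (∀ w → g w ≡ true → w ≡ a)
count≡1⇒unique {suc m} g c≡1 with g zero in g₀
... | true  = zero , g₀ , only-zero
  where
  only-zero : ∀ w → g w ≡ true → w ≡ zero
  only-zero zero    _  = refl
  only-zero (suc w) gw with () ← trans (sym gw) (count≡0⇒false (g ∘ suc) (cong pred c≡1) w)
... | false with a , ga , only-a ← count≡1⇒unique (g ∘ suc) c≡1 = suc a , ga , only-suc-a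
  where
  only-suc-a : ∀ w → g w ≡ true → w ≡ suc a
  only-suc-a zero    gw with () ← trans (sym gw) g₀
  only-suc-a (suc w) gw = cong suc (only-a w gw)

record ExactlyTwo {m} (g : Fin m → Bool) : Set where
  field
    fst snd  : Fin m
    fst≢snd  : fst ≢ snd
    fst-true : g fst ≡ true
    snd-true : g snd ≡ true
    only     : ∀ w → g w ≡ true → w ≡ fst ⊎ w ≡ snd

count≡2⇒ExactlyTwo : ∀ {m} (g : Fin m → Bool) → count g ≡ 2 → ExactlyTwo g
count≡2⇒ExactlyTwo {suc m} g c≡2 with g zero in g₀
... | true with b , gb , only-b ← count≡1⇒unique (g ∘ suc) (cong pred c≡2) =
  record { fst = zero ; snd = suc b ; fst≢snd = λ () ; fst-true = g₀ ; snd-true = gb ; only = only }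
  where
  only : ∀ w → g w ≡ true → w ≡ zero ⊎ w ≡ suc b
  only zero    _  = inj₁ refl
  only (suc w) gw = inj₂ (cong suc (only-b w gw))
... | false = record
  { fst = suc fst ; snd = suc snd ; fst≢snd = fst≢snd ∘ suc-injective
  ; fst-true = fst-true ; snd-true = snd-true ; only = only′ }
  where
  open ExactlyTwo (count≡2⇒ExactlyTwo (g ∘ suc) c≡2)
  only′ : ∀ w → g w ≡ true → w ≡ suc fst ⊎ w ≡ suc snd
  only′ zero    gw with () ← trans (sym gw) g₀
  only′ (suc w) gw = ⊎.map (cong suc) (cong suc) (only w gw)

apply : {G H : Graph} → G ≅ H → Fin (n G) → Fin (n H)
apply σ = Inverse.to (_≅_.bij σ)

apply-injective : {G H : Graph} (σ : G ≅ H) → ∀ {u v} → apply σ u ≡ apply σ v → u ≡ v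
apply-injective σ {u} {v} e = trans (sym (strictlyInverseʳ u)) (trans (cong from e) (strictlyInverseʳ v))
  where open Inverse (_≅_.bij σ)

≅-refl : {G : Graph} → G ≅ G
≅-refl = record { bij = ↔-refl ; preserve = λ _ _ → refl }

≅-sym : {G H : Graph} → G ≅ H → H ≅ G
≅-sym {G} {H} σ = record
  { bij      = ↔-sym bij
  ; preserve = λ u v → trans (sym (preserve (from u) (from v)))
                             (cong₂ (Adj H) (strictlyInverseˡ u) (strictlyInverseˡ v)) }
  where open _≅_ σ; open Inverse bij

≅-trans : {G H K : Graph} → G ≅ H → H ≅ K → G ≅ K
≅-trans σ τ = record
  { bij      = ↔-trans (_≅_.bij σ) (_≅_.bij τ)
  ; preserve = λ u v → trans (_≅_.preserve τ _ _) (_≅_.preserve σ u v) }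

≅-via-from : {G H : Graph} (b : Fin (n G) ↔ Fin (n H)) →
             (∀ i j → Adj H i j ≡ Adj G (Inverse.from b i) (Inverse.from b j)) → G ≅ H
≅-via-from {G} b adj = record
  { bij      = b
  ; preserve = λ u v → trans (adj (to u) (to v)) (cong₂ (Adj G) (strictlyInverseʳ u) (strictlyInverseʳ v)) }
  where open Inverse b

_^_ : {G : Graph} → Automorphism G → ℕ → Automorphism G
σ ^ zero  = ≅-refl
σ ^ suc k = ≅-trans (σ ^ k) σ

minimal : {P : ℕ → Set} → (∀ k → Dec (P k)) → ∀ {k} → P k →
          ∃ λ m → P m × (∀ {j} → j < m → ¬ P j)
minimal {P} P? {k} = go (<-wellFounded k)
  where
  go : ∀ {k} → Acc _<_ k → P k → ∃ λ m → P m × (∀ {j} → j < m → ¬ P j)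
  go {k} (acc smaller) Pk with anyUpTo? P? k
  ... | yes (j , j<k , Pj) = go (smaller j<k) Pj
  ... | no  none           = k , Pk , λ j<k Pj → none (_ , j<k , Pj)

true⇔true⇒≡ : ∀ {a b : Bool} → (a ≡ true → b ≡ true) → (b ≡ true → a ≡ true) → a ≡ b
true⇔true⇒≡ {false} {false} _ _ = refl
true⇔true⇒≡ {false} {true}  _ b⇒a = b⇒a refl
true⇔true⇒≡ {true}  {false} a⇒b _ = sym (a⇒b refl)
true⇔true⇒≡ {true}  {true}  _ _ = refl

module SimpleGraph {G : Graph} (simple : IsSimple G) where

  V : Set
  V = Fin (n G)

  infix 4 _~_
  _~_ : V → V → Set
  u ~ v = Adj G u v ≡ true

  ~-sym : ∀ {u v} → u ~ v → v ~ u
  ~-sym {u} {v} u~v = trans (symmetric simple v u) u~v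

  ~⇒≢ : ∀ {u v} → u ~ v → u ≢ v
  ~⇒≢ {u} u~u refl with () ← trans (sym u~u) (loopless simple u)

  ≁⇒false : ∀ {u v} → ¬ u ~ v → Adj G u v ≡ false
  ≁⇒false = ¬-not

module TwoRegular {G : Graph} (simple : IsSimple G) (regular : Regular 2 G) where

  open SimpleGraph simple public

  private
    neighbours : ∀ v → ExactlyTwo (Adj G v)
    neighbours v = count≡2⇒ExactlyTwo (Adj G v) (trans (sym (degree≡count G v)) (regular v))
    module N v = ExactlyTwo (neighbours v)

  nbr₁ nbr₂ : V → V
  nbr₁ v = N.fst v
  nbr₂ v = N.snd v

  nbr₁≢nbr₂ : ∀ v → nbr₁ v ≢ nbr₂ v
  nbr₁≢nbr₂ v = N.fst≢snd v

  ~nbr₁ : ∀ v → v ~ nbr₁ v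
  ~nbr₁ v = N.fst-true v

  ~nbr₂ : ∀ v → v ~ nbr₂ v
  ~nbr₂ v = N.snd-true v

  ~⇒nbr : ∀ {v w} → v ~ w → w ≡ nbr₁ v ⊎ w ≡ nbr₂ v
  ~⇒nbr = N.only _ _

  closed-nbhd-distinct : ∀ v → Unique (v ∷ nbr₁ v ∷ nbr₂ v ∷ [])
  closed-nbhd-distinct v = (~⇒≢ (~nbr₁ v) ∷ ~⇒≢ (~nbr₂ v) ∷ []) ∷ (nbr₁≢nbr₂ v ∷ []) ∷ [] ∷ []

  3≤order : V → 3 ≤ n G
  3≤order v = injective⇒≤ (λ {i} {j} → lookup-injective (closed-nbhd-distinct v) i j)

  two-neighbours : ∀ {v p q r} → v ~ p → v ~ q → p ≢ q → v ~ r → r ≡ p ⊎ r ≡ q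
  two-neighbours {v} v~p v~q p≢q v~r with ~⇒nbr v~p | ~⇒nbr v~q | ~⇒nbr v~r
  ... | inj₁ refl | inj₁ refl | _         = ⊥-elim (p≢q refl)
  ... | inj₂ refl | inj₂ refl | _         = ⊥-elim (p≢q refl)
  ... | inj₁ refl | inj₂ refl | inj₁ refl = inj₁ refl
  ... | inj₁ refl | inj₂ refl | inj₂ refl = inj₂ refl
  ... | inj₂ refl | inj₁ refl | inj₁ refl = inj₂ refl
  ... | inj₂ refl | inj₁ refl | inj₂ refl = inj₁ refl

  other : V → V → V
  other p v with p ≟ nbr₁ v
  ... | yes _ = nbr₂ v
  ... | no  _ = nbr₁ v

  ~other : ∀ p v → v ~ other p v
  ~other p v with p ≟ nbr₁ v
  ... | yes _ = ~nbr₂ v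
  ... | no  _ = ~nbr₁ v

  other≢ : ∀ p v → other p v ≢ p
  other≢ p v with p ≟ nbr₁ v
  ... | yes p≡nbr₁ = λ nbr₂≡p → nbr₁≢nbr₂ v (trans (sym p≡nbr₁) (sym nbr₂≡p))
  ... | no  p≢nbr₁ = p≢nbr₁ ∘ sym

  ~⇒other : ∀ {p v r} → v ~ p → v ~ r → r ≡ p ⊎ r ≡ other p v
  ~⇒other {p} {v} v~p = two-neighbours v~p (~other p v) (other≢ p v ∘ sym)

  other-other : ∀ {p v} → v ~ p → other (other p v) v ≡ p
  other-other {p} {v} v~p with ~⇒other (~other p v) v~p
  ... | inj₁ p≡other  = ⊥-elim (other≢ p v (sym p≡other))
  ... | inj₂ p≡other² = sym p≡other²

  non-nbr⇒≁ : ∀ {t r} → r ≢ nbr₁ t → r ≢ nbr₂ t → ¬ t ~ r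
  non-nbr⇒≁ r≢nbr₁ r≢nbr₂ t~r = [ r≢nbr₁ , r≢nbr₂ ] (~⇒nbr t~r)

  module Walk {z x : V} (z~x : z ~ x) where

    walk : ℕ → V
    walk zero          = z
    walk (suc zero)    = x
    walk (suc (suc t)) = other (walk t) (walk (suc t))

    walk-~ : ∀ t → walk t ~ walk (suc t)
    walk-~ zero    = z~x
    walk-~ (suc t) = ~other (walk t) (walk (suc t))

    walk-no-backtrack : ∀ t → walk (2 + t) ≢ walk t
    walk-no-backtrack t = other≢ (walk t) (walk (suc t))

    walk-nbrs : ∀ t {w} → walk (suc t) ~ w → w ≡ walk t ⊎ w ≡ walk (2 + t)
    walk-nbrs t = ~⇒other (~-sym (walk-~ t))

    walk-shift : ∀ {a b} → walk a ≡ walk b → walk (suc a) ≡ walk (suc b) →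
                 ∀ t → walk (t + a) ≡ walk (t + b)
    walk-shift {a} {b} e₀ e₁ t = proj₁ (step t)
      where
      step : ∀ t → walk (t + a) ≡ walk (t + b) × walk (suc t + a) ≡ walk (suc t + b)
      step zero    = e₀ , e₁
      step (suc t) = proj₂ (step t) , cong₂ other (proj₁ (step t)) (proj₂ (step t))

    Revisit : ℕ → Set
    Revisit j = ∃ λ i → i < j × walk i ≡ walk j

    private
      first-revisit : ∃ λ m → Revisit m × (∀ {j} → j < m → ¬ Revisit j)
      first-revisit = minimal (λ j → anyUpTo? (λ i → walk i ≟ walk j) j) (proj₂ some-revisit)
        where
        some-revisit : ∃ Revisit
        some-revisit with i , j , i<j , e ← pigeonhole (n<1+n (n G)) (walk ∘ toℕ) =
          toℕ j , toℕ i , i<j , e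

    len : ℕ
    len = proj₁ first-revisit

    no-revisit-before-len : ∀ {j} → j < len → ¬ Revisit j
    no-revisit-before-len = proj₂ (proj₂ first-revisit)

    walk-injective : ∀ {i j} → i < len → j < len → walk i ≡ walk j → i ≡ j
    walk-injective {i} {j} i<len j<len e with <-cmp i j
    ... | tri< i<j _ _ = ⊥-elim (no-revisit-before-len j<len (i , i<j , e))
    ... | tri≈ _ i≡j _ = i≡j
    ... | tri> _ _ j<i = ⊥-elim (no-revisit-before-len i<len (j , j<i , sym e))

    -- If walk i with i > 0 were revisited first, at walk m, then the neighbour walk (m - 1) of walk i
    -- would be walk (i - 1) or walk (i + 1): an earlier revisit, a backtrack or a loop.
    first-revisit-at-start : ∀ {i m} → (∀ {j} → j < m → ¬ Revisit j) →
                             i < m → walk i ≡ walk m → i ≡ 0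
    first-revisit-at-start {zero} _ _ _ = refl
    first-revisit-at-start {suc i} {suc m} none (s≤s i<m) e
      with walk-nbrs i (subst (_~ walk m) (sym e) (~-sym (walk-~ m)))
    ... | inj₁ m≡i = ⊥-elim (none (n<1+n m) (i , i<m , sym m≡i))
    ... | inj₂ m≡2+i with <-cmp (2 + i) m
    ...   | tri< 2+i<m _ _ = ⊥-elim (none (n<1+n m) (2 + i , 2+i<m , sym m≡2+i))
    ...   | tri≈ _ refl _  = ⊥-elim (walk-no-backtrack (suc i) (sym e))
    ...   | tri> _ _ m<2+i with refl ← ≤-antisym (s≤s⁻¹ m<2+i) i<m = ⊥-elim (~⇒≢ (walk-~ (suc i)) e)

    walk-len : walk len ≡ z
    walk-len with i , i<len , e ← proj₁ (proj₂ first-revisit)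
             with refl ← first-revisit-at-start no-revisit-before-len i<len e = sym e

    return-time≥3 : ∀ {m} → 0 < m → walk m ≡ z → 3 ≤ m
    return-time≥3 {1}           _ x≡z = ⊥-elim (~⇒≢ z~x (sym x≡z))
    return-time≥3 {2}           _ e   = ⊥-elim (walk-no-backtrack 0 e)
    return-time≥3 {suc (suc (suc m))} _ _ = s≤s (s≤s (s≤s z≤n))

    0<len : 0 < len
    0<len with i , i<len , _ ← proj₁ (proj₂ first-revisit) = ≤-<-trans z≤n i<len

    instance
      len-nonZero : NonZero len
      len-nonZero = >-nonZero 0<len

    3≤len : 3 ≤ len
    3≤len = return-time≥3 0<len walk-len

    walk-pred-len : walk (pred len) ≡ other x z
    walk-pred-len with ~⇒other z~x z~walk-pred-len
      where
      z~walk-pred-len : z ~ walk (pred len)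
      z~walk-pred-len = subst (_~ walk (pred len)) (trans (cong walk (suc-pred len)) walk-len)
                              (~-sym (walk-~ (pred len)))
    ... | inj₂ e = e
    ... | inj₁ e with s≤s () ← subst (2 ≤_) (walk-injective (≤-reflexive (suc-pred len))
                                                      (≤-trans (s≤s (s≤s z≤n)) 3≤len) e)
                                 (pred-mono-≤ 3≤len)

    walk-suc-len : walk (suc len) ≡ x
    walk-suc-len = begin
      walk (suc len)                                  ≡⟨ cong (walk ∘ suc) (suc-pred len) ⟨
      other (walk (pred len)) (walk (suc (pred len))) ≡⟨ cong₂ other walk-pred-len
                                                           (trans (cong walk (suc-pred len)) walk-len) ⟩
      other (other x z) z                             ≡⟨ other-other z~x ⟩
      x                                               ∎

    walk-periodic : ∀ t → walk (len + t) ≡ walk t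
    walk-periodic t = begin
      walk (len + t) ≡⟨ cong walk (+-comm len t) ⟩
      walk (t + len) ≡⟨ walk-shift (sym walk-len) (sym walk-suc-len) t ⟨
      walk (t + 0)   ≡⟨ cong walk (+-identityʳ t) ⟩
      walk t         ∎

    walk-+* : ∀ r q → walk (r + q * len) ≡ walk r
    walk-+* r zero    = cong walk (+-identityʳ r)
    walk-+* r (suc q) = begin
      walk (r + (len + q * len)) ≡⟨ cong walk (x∙yz≈y∙xz r len (q * len)) ⟩
      walk (len + (r + q * len)) ≡⟨ walk-periodic (r + q * len) ⟩
      walk (r + q * len)         ≡⟨ walk-+* r q ⟩
      walk r                     ∎

    walk-mod : ∀ s t → walk (s + t) ≡ walk (s + t % len)
    walk-mod s t = begin
      walk (s + t)                         ≡⟨ cong (λ u → walk (s + u)) (m≡m%n+[m/n]*n t len) ⟩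
      walk (s + (t % len + t / len * len)) ≡⟨ cong walk (+-assoc s (t % len) (t / len * len)) ⟨
      walk (s + t % len + t / len * len)   ≡⟨ walk-+* (s + t % len) (t / len) ⟩
      walk (s + t % len)                   ∎

    walk-cong : ∀ {i t} → walk i ≡ walk t → ∀ s → walk (s + i) ≡ walk (s + t)
    walk-cong {i} {t} e s = begin
      walk (s + i)       ≡⟨ walk-mod s i ⟩
      walk (s + i % len) ≡⟨ cong (λ u → walk (s + u)) i%len≡t%len ⟩
      walk (s + t % len) ≡⟨ walk-mod s t ⟨
      walk (s + t)       ∎
      where
      i%len≡t%len : i % len ≡ t % len
      i%len≡t%len = walk-injective (m%n<n i len) (m%n<n t len)
                      (trans (sym (walk-mod 0 i)) (trans e (walk-mod 0 t)))

    walk-len-minimal : ∀ {p} → 0 < p → walk p ≡ z → len ≤ p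
    walk-len-minimal {p} 0<p e = ≮⇒≥ λ p<len → <-irrefl (walk-injective 0<len p<len (sym e)) 0<p

    OnCycle : V → Set
    OnCycle v = ∃ λ i → i < len × walk i ≡ v

    on-cycle? : ∀ v → Dec (OnCycle v)
    on-cycle? v = anyUpTo? (λ i → walk i ≟ v) len

    walk-on-cycle : ∀ t → OnCycle (walk t)
    walk-on-cycle t = t % len , m%n<n t len , sym (walk-mod 0 t)

    cycle-cases : ∀ v → (∃ λ s → walk (suc s) ≡ v) ⊎ ¬ OnCycle v
    cycle-cases v with on-cycle? v
    ... | no  off            = inj₂ off
    ... | yes (i , _ , refl) =
      inj₁ (pred len + i , trans (cong (λ m → walk (m + i)) (suc-pred len)) (walk-periodic i))

    private
      forward backward : V → V
      forward v with on-cycle? v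
      ... | yes (i , _ , _) = walk (suc i)
      ... | no  _           = v
      backward v with on-cycle? v
      ... | yes (i , _ , _) = walk (pred len + i)
      ... | no  _           = v

      forward-walk : ∀ t → forward (walk t) ≡ walk (suc t)
      forward-walk t with on-cycle? (walk t)
      ... | yes (i , _ , e) = walk-cong {i} {t} e 1
      ... | no  off         = ⊥-elim (off (walk-on-cycle t))

      backward-walk : ∀ t → backward (walk (suc t)) ≡ walk t
      backward-walk t with on-cycle? (walk (suc t))
      ... | no  off         = ⊥-elim (off (walk-on-cycle (suc t)))
      ... | yes (i , _ , e) = begin
        walk (pred len + i)     ≡⟨ walk-cong e (pred len) ⟩
        walk (pred len + suc t) ≡⟨ cong walk (+-suc (pred len) t) ⟩
        walk (suc (pred len) + t) ≡⟨ cong (λ m → walk (m + t)) (suc-pred len) ⟩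
        walk (len + t)          ≡⟨ walk-periodic t ⟩
        walk t                  ∎

      forward-off : ∀ {v} → ¬ OnCycle v → forward v ≡ v
      forward-off {v} off with on-cycle? v
      ... | yes on = ⊥-elim (off on)
      ... | no  _  = refl

      backward-off : ∀ {v} → ¬ OnCycle v → backward v ≡ v
      backward-off {v} off with on-cycle? v
      ... | yes on = ⊥-elim (off on)
      ... | no  _  = refl

      forward-backward : ∀ v → forward (backward v) ≡ v
      forward-backward v with cycle-cases v
      ... | inj₁ (s , refl) = trans (cong forward (backward-walk s)) (forward-walk s)
      ... | inj₂ off        = trans (cong forward (backward-off off)) (forward-off off)

      backward-forward : ∀ v → backward (forward v) ≡ v
      backward-forward v with cycle-cases v
      ... | inj₁ (s , refl) = trans (cong backward (forward-walk (suc s))) (backward-walk (suc s))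
      ... | inj₂ off        = trans (cong backward (forward-off off)) (backward-off off)

      forward≡walk : ∀ {v w} → forward v ≡ walk (suc w) → v ≡ walk w
      forward≡walk {v} {w} e = trans (sym (backward-forward v)) (trans (cong backward e) (backward-walk w))

      forward-preserves-walk : ∀ s v → Adj G (forward (walk (suc s))) (forward v) ≡ Adj G (walk (suc s)) v
      forward-preserves-walk s v = trans (cong (λ w → Adj G w (forward v)) (forward-walk (suc s)))
                                         (true⇔true⇒≡ reflects preserves)
        where
        reflects : walk (2 + s) ~ forward v → walk (suc s) ~ v
        reflects a with walk-nbrs (suc s) a
        ... | inj₁ e = subst (walk (suc s) ~_) (sym (forward≡walk {w = s} e)) (~-sym (walk-~ s))
        ... | inj₂ e = subst (walk (suc s) ~_) (sym (forward≡walk {w = 2 + s} e)) (walk-~ (suc s))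
        preserves : walk (suc s) ~ v → walk (2 + s) ~ forward v
        preserves a with walk-nbrs s a
        ... | inj₁ refl = subst (walk (2 + s) ~_) (sym (forward-walk s)) (~-sym (walk-~ (suc s)))
        ... | inj₂ refl = subst (walk (2 + s) ~_) (sym (forward-walk (2 + s))) (walk-~ (2 + s))

      forward-preserves : ∀ u v → Adj G (forward u) (forward v) ≡ Adj G u v
      forward-preserves u v with cycle-cases u | cycle-cases v
      ... | inj₁ (s , refl) | _               = forward-preserves-walk s v
      ... | inj₂ _          | inj₁ (s , refl) =
        trans (symmetric simple _ _) (trans (forward-preserves-walk s u) (symmetric simple _ _))
      ... | inj₂ u-off      | inj₂ v-off      = cong₂ (Adj G) (forward-off u-off) (forward-off v-off)

    rotation : Automorphism G
    rotation = record
      { bij      = mk↔ₛ′ forward backward forward-backward backward-forward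
      ; preserve = forward-preserves }

    rotation^-walk : ∀ k t → apply (rotation ^ k) (walk t) ≡ walk (k + t)
    rotation^-walk zero    t = refl
    rotation^-walk (suc k) t = trans (cong forward (rotation^-walk k t)) (forward-walk (k + t))

    rotation^-off : ∀ {v} → ¬ OnCycle v → ∀ k → apply (rotation ^ k) v ≡ v
    rotation^-off off zero    = refl
    rotation^-off off (suc k) = trans (cong forward (rotation^-off off k)) (forward-off off)

    color-period⇒walk-period : ∀ {k} {c : Coloring G k} → Distinguishing c → ∀ p →
                                (∀ t → col c (walk (p + t)) ≡ col c (walk t)) → walk p ≡ z
    color-period⇒walk-period {c = c} distinguishing p period =
      trans (cong walk (sym (+-identityʳ p)))
            (trans (sym (rotation^-walk p 0)) (distinguishing (rotation ^ p) fixes z))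
      where
      fixes : Fixes c (rotation ^ p)
      fixes v with cycle-cases v
      ... | inj₁ (s , refl) = trans (cong (col c) (rotation^-walk p (suc s))) (period (suc s))
      ... | inj₂ off        = cong (col c) (rotation^-off off p)

pullback : {G : Graph} {k : ℕ} (c : Coloring G k) → Distinguishing c → Automorphism G → HasDistColoring G k
pullback {G} {k} c distinguishing σ = c∘σ , c∘σ-distinguishing
  where
  open Inverse (_≅_.bij σ)

  c∘σ : Coloring G k
  c∘σ = record
    { col    = col c ∘ to
    ; onto   = λ j → from (proj₁ (onto c j)) ,
                     λ e → trans (cong (col c ∘ to) e) (proj₂ (onto c j) (strictlyInverseˡ _))
    ; proper = λ u v u~v → proper c (to u) (to v) (trans (_≅_.preserve σ u v) u~v) }

  c∘σ-distinguishing : Distinguishing c∘σ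
  c∘σ-distinguishing τ fixes v = begin
    apply τ v                 ≡⟨ strictlyInverseʳ (apply τ v) ⟨
    from (to (apply τ v))     ≡⟨ cong (from ∘ to ∘ apply τ) (strictlyInverseʳ v) ⟨
    from (apply στσ⁻¹ (to v)) ≡⟨ cong from (distinguishing στσ⁻¹ στσ⁻¹-fixes (to v)) ⟩
    from (to v)               ≡⟨ strictlyInverseʳ v ⟩
    v                         ∎
    where
    στσ⁻¹ : Automorphism G
    στσ⁻¹ = ≅-trans (≅-trans (≅-sym σ) τ) σ
    στσ⁻¹-fixes : Fixes c στσ⁻¹
    στσ⁻¹-fixes w = trans (fixes (from w)) (cong (col c) (strictlyInverseˡ w))

UniqueDistPartition : Graph → ℕ → Set
UniqueDistPartition G k = (c₁ c₂ : HasDistColoring G k) → SamePartition (proj₁ c₁) (proj₁ c₂)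

module UniqueColoring {G : Graph} (simple : IsSimple G) {k : ℕ}
  (c : Coloring G k) (distinguishing : Distinguishing c) (unique : UniqueDistPartition G k) where

  open SimpleGraph simple

  C : V → Fin k
  C = col c

  Singleton : V → Set
  Singleton v = ∀ u → C u ≡ C v → u ≡ v

  classmates-not-singleton : ∀ {u w s} → u ≢ w → C u ≡ C w → Singleton s → C w ≢ C s
  classmates-not-singleton {u} {w} u≢w Cu≡Cw s-single Cw≡Cs =
    u≢w (trans (s-single u (trans Cu≡Cw Cw≡Cs)) (sym (s-single w Cw≡Cs)))

  automorphism-preserves-classes : ∀ σ {u v} → C u ≡ C v → C (apply σ u) ≡ C (apply σ v)
  automorphism-preserves-classes σ {u} {v} =
    Equivalence.to (unique (c , distinguishing) (pullback c distinguishing σ) u v)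

  automorphism-reflects-classes : ∀ σ {u v} → C (apply σ u) ≡ C (apply σ v) → C u ≡ C v
  automorphism-reflects-classes σ {u} {v} =
    Equivalence.from (unique (c , distinguishing) (pullback c distinguishing σ) u v)

  private
    module Recoloring {w u : V} (u≢w : u ≢ w) (Cu≡Cw : C u ≡ C w) {b : Fin k} (Cw≢b : C w ≢ b)
                       (free : ∀ {v} → w ~ v → C v ≢ b) where

      color : V → Fin k
      color v with v ≟ w
      ... | yes _ = b
      ... | no  _ = C v

      color-w : color w ≡ b
      color-w with w ≟ w
      ... | yes _   = refl
      ... | no  w≢w = ⊥-elim (w≢w refl)

      color-≢w : ∀ {v} → v ≢ w → color v ≡ C v
      color-≢w {v} v≢w with v ≟ w
      ... | yes v≡w = ⊥-elim (v≢w v≡w)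
      ... | no  _   = refl

      color-u : color u ≡ C w
      color-u = trans (color-≢w u≢w) Cu≡Cw

      recolored : Coloring G k
      recolored = record { col = color ; onto = color-onto ; proper = color-proper }
        where
        preimage : ∀ j → ∃ λ v → color v ≡ j
        preimage j with proj₁ (onto c j) ≟ w | proj₂ (onto c j) refl
        ... | no  x≢w  | Cx≡j = proj₁ (onto c j) , trans (color-≢w x≢w) Cx≡j
        ... | yes refl | Cw≡j = u , trans color-u Cw≡j

        color-onto : Surjective _≡_ _≡_ color
        color-onto j = proj₁ (preimage j) , λ e → trans (cong color e) (proj₂ (preimage j))

        color-proper : ∀ v v′ → v ~ v′ → color v ≢ color v′
        color-proper v v′ v~v′ with v ≟ w | v′ ≟ w
        ... | yes refl | yes refl = λ _ → ~⇒≢ v~v′ refl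
        ... | yes refl | no  _    = λ e → free v~v′ (sym e)
        ... | no  _    | yes refl = λ e → free (~-sym v~v′) e
        ... | no  _    | no  _    = proper c v v′ v~v′

      recolored-distinguishing : Distinguishing recolored
      recolored-distinguishing σ fixes = distinguishing σ fixes-c
        where
        σu≢w : apply σ u ≢ w
        σu≢w σu≡w = Cw≢b (begin
          C w                ≡⟨ color-u ⟨
          color u           ≡⟨ fixes u ⟨
          color (apply σ u) ≡⟨ cong color σu≡w ⟩
          color w           ≡⟨ color-w ⟩
          b                  ∎)

        Cσu≡Cw : C (apply σ u) ≡ C w
        Cσu≡Cw = trans (sym (color-≢w σu≢w)) (trans (fixes u) color-u)

        fixes-c : Fixes c σ
        fixes-c v with v ≟ w
        ... | yes refl = trans (automorphism-preserves-classes σ (sym Cu≡Cw)) Cσu≡Cw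
        ... | no  v≢w with apply σ v ≟ w
        ...   | no  σv≢w = trans (sym (color-≢w σv≢w)) (trans (fixes v) (color-≢w v≢w))
        ...   | yes σv≡w = trans (cong C σv≡w) (sym (trans Cv≡Cu Cu≡Cw))
          where
          Cv≡Cu : C v ≡ C u
          Cv≡Cu = automorphism-reflects-classes σ (trans (cong C σv≡w) (sym Cσu≡Cw))

  free-color⇒singleton : ∀ {w b} → C w ≢ b → (∀ {v} → w ~ v → C v ≢ b) → Singleton w
  free-color⇒singleton {w} {b} Cw≢b free u Cu≡Cw with u ≟ w
  ... | yes u≡w = u≡w
  ... | no  u≢w = ⊥-elim (Cw≢b (begin
    C w      ≡⟨ color-u ⟨
    color u ≡⟨ Equivalence.to (unique (c , distinguishing) (recolored , recolored-distinguishing) u w) Cu≡Cw ⟩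
    color w ≡⟨ color-w ⟩
    b        ∎))
    where open Recoloring u≢w Cu≡Cw Cw≢b free

-- Give v the color of u and every other vertex a color of its own; an automorphism preserving
-- this partition fixes x, hence cannot swap u (adjacent to x) with v (not adjacent to x).
merged-coloring : {G : Graph} → IsSimple G → ∀ {m} → n G ≡ suc m → ∀ {u v x : Fin (n G)} →
                   u ≢ v → Adj G u v ≡ false → Adj G u x ≡ true → Adj G v x ≡ false → HasDistColoring G m
merged-coloring {G} simple {m} refl {u} {v} {x} u≢v u≁v u~x v≁x = merged , merged-distinguishing
  where
  open SimpleGraph simple

  color : V → Fin m
  color w with v ≟ w
  ... | yes _   = punchOut (u≢v ∘ sym)
  ... | no  v≢w = punchOut v≢w

  color-punchIn : ∀ j → color (punchIn v j) ≡ j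
  color-punchIn j with v ≟ punchIn v j
  ... | yes v≡ = ⊥-elim (punchInᵢ≢i v j (sym v≡))
  ... | no  _  = trans (punchOut-cong v refl) (punchOut-punchIn v)

  same-color : ∀ {a b} → color a ≡ color b → a ≡ b ⊎ (a ≡ v × b ≡ u) ⊎ (a ≡ u × b ≡ v)
  same-color {a} {b} e with v ≟ a | v ≟ b
  ... | yes v≡a | yes v≡b = inj₁ (trans (sym v≡a) v≡b)
  ... | yes v≡a | no  v≢b = inj₂ (inj₁ (sym v≡a , sym (punchOut-injective (u≢v ∘ sym) v≢b e)))
  ... | no  v≢a | yes v≡b = inj₂ (inj₂ (punchOut-injective v≢a (u≢v ∘ sym) e , sym v≡b))
  ... | no  v≢a | no  v≢b = inj₁ (punchOut-injective v≢a v≢b e)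

  merged : Coloring G m
  merged = record
    { col    = color
    ; onto   = λ j → punchIn v j , λ e → trans (cong color e) (color-punchIn j)
    ; proper = λ a b a~b e → case-proper a~b (same-color e) }
    where
    case-proper : ∀ {a b} → a ~ b → a ≡ b ⊎ (a ≡ v × b ≡ u) ⊎ (a ≡ u × b ≡ v) → ⊥
    case-proper a~b (inj₁ a≡b)                = ~⇒≢ a~b a≡b
    case-proper v~u (inj₂ (inj₁ (refl , refl))) with () ← trans (sym (~-sym v~u)) u≁v
    case-proper u~v (inj₂ (inj₂ (refl , refl))) with () ← trans (sym u~v) u≁v

  merged-distinguishing : Distinguishing merged
  merged-distinguishing σ fixes = fixed
    where
    outside : ∀ {w} → w ≢ u → w ≢ v → apply σ w ≡ w
    outside {w} w≢u w≢v with same-color (fixes w)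
    ... | inj₁ σw≡w             = σw≡w
    ... | inj₂ (inj₁ (_ , w≡u)) = ⊥-elim (w≢u w≡u)
    ... | inj₂ (inj₂ (_ , w≡v)) = ⊥-elim (w≢v w≡v)

    σx≡x : apply σ x ≡ x
    σx≡x = outside (~⇒≢ u~x ∘ sym) λ { refl → case trans (sym u~x) u≁v of λ () }

    σu≡u : apply σ u ≡ u
    σu≡u with same-color (fixes u)
    ... | inj₁ σu≡u              = σu≡u
    ... | inj₂ (inj₂ (σu≡u , _)) = σu≡u
    ... | inj₂ (inj₁ (σu≡v , _)) with () ← begin
      false                         ≡⟨ v≁x ⟨
      Adj G v x                     ≡⟨ cong₂ (Adj G) σu≡v σx≡x ⟨
      Adj G (apply σ u) (apply σ x) ≡⟨ _≅_.preserve σ u x ⟩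
      Adj G u x                     ≡⟨ u~x ⟩
      true                          ∎

    σv≡v : apply σ v ≡ v
    σv≡v with same-color (fixes v)
    ... | inj₁ σv≡v              = σv≡v
    ... | inj₂ (inj₁ (σv≡v , _)) = σv≡v
    ... | inj₂ (inj₂ (σv≡u , _)) = ⊥-elim (u≢v (sym (apply-injective σ (trans σv≡u (sym σu≡u)))))

    fixed : ∀ w → apply σ w ≡ w
    fixed w with w ≟ u | w ≟ v
    ... | yes refl | _        = σu≡u
    ... | no  _    | yes refl = σv≡v
    ... | no  w≢u  | no  w≢v  = outside w≢u w≢v

module TwoRegularColorings {G : Graph} (simple : IsSimple G) (regular : Regular 2 G) where

  open TwoRegular simple regular

  smaller-distinguishing-coloring : ∀ {m} → n G ≡ suc m → 4 < n G → HasDistColoring G m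
  smaller-distinguishing-coloring eq 4<n
    with u , _  ← fresh (≤-trans (s≤s z≤n) 4<n) []
    with v , v∉ ← fresh 4<n (u ∷ nbr₁ u ∷ nbr₂ u ∷ other u (nbr₁ u) ∷ []) =
    merged-coloring simple eq u≢v (≁⇒false u≁v) (~nbr₁ u) (≁⇒false v≁x)
    where
    x : V
    x = nbr₁ u
    u≢v : u ≢ v
    u≢v = v∉ ∘ here ∘ sym
    u≁v : ¬ u ~ v
    u≁v = non-nbr⇒≁ (v∉ ∘ there ∘ here) (v∉ ∘ there ∘ there ∘ here)
    v≁x : ¬ v ~ x
    v≁x v~x with ~⇒other (~-sym (~nbr₁ u)) (~-sym v~x)
    ... | inj₁ v≡u      = v∉ (here v≡u)
    ... | inj₂ v≡other = v∉ (there (there (there (here v≡other))))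

  no-distinguishing-2-coloring : (c : Coloring G 2) → ¬ Distinguishing c
  no-distinguishing-2-coloring c distinguishing =
    walk-no-backtrack 0 (color-period⇒walk-period {c = c} distinguishing 2 alternating)
    where
    z : V
    z = proj₁ (onto c zero)
    open Walk (~nbr₁ z)
    alternating : ∀ t → col c (walk (2 + t)) ≡ col c (walk t)
    alternating t = ∉tail⇒≡head ((proper c _ _ (walk-~ t) ∷ []) ∷ [] ∷ [])
                      λ { (here e) → proper c _ _ (walk-~ (suc t)) (sym e) ; (there ()) }

  module UniquelyColored {k} (c : Coloring G k) (distinguishing : Distinguishing c)
                          (unique : UniqueDistPartition G k) where

    open UniqueColoring simple c distinguishing unique public

    equal-neighbours⇒singleton : 2 < k → ∀ {v p q} → v ~ p → v ~ q → p ≢ q → C p ≡ C q → Singleton v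
    equal-neighbours⇒singleton 2<k {v} {p} v~p v~q p≢q Cp≡Cq
      with b , b∉ ← fresh 2<k (C v ∷ C p ∷ []) = free-color⇒singleton (b∉ ∘ here ∘ sym) free
      where
      free : ∀ {r} → v ~ r → C r ≢ b
      free v~r with two-neighbours v~p v~q p≢q v~r
      ... | inj₁ refl = λ e → b∉ (there (here (sym e)))
      ... | inj₂ refl = λ e → b∉ (there (here (sym (trans Cp≡Cq e))))

    ≥4-colors⇒singleton : 3 < k → ∀ w → Singleton w
    ≥4-colors⇒singleton 3<k w
      with b , b∉ ← fresh 3<k (C w ∷ C (nbr₁ w) ∷ C (nbr₂ w) ∷ []) = free-color⇒singleton (b∉ ∘ here ∘ sym) free
      where
      free : ∀ {r} → w ~ r → C r ≢ b
      free w~r with ~⇒nbr w~r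
      ... | inj₁ refl = λ e → b∉ (there (here (sym e)))
      ... | inj₂ refl = λ e → b∉ (there (there (here (sym e))))

  module ThreeColored (c : Coloring G 3) (distinguishing : Distinguishing c)
                       (unique : UniqueDistPartition G 3) where

    open UniquelyColored c distinguishing unique

    singleton-near-rainbow : ∀ {r t} → C (nbr₁ r) ≢ C (nbr₂ r) → Singleton t → t ≡ r ⊎ r ~ t
    singleton-near-rainbow {r} {t} differ t-single = among (unique⇒∈ rainbow (C t))
      where
      rainbow : Unique (C r ∷ C (nbr₁ r) ∷ C (nbr₂ r) ∷ [])
      rainbow = (proper c _ _ (~nbr₁ r) ∷ proper c _ _ (~nbr₂ r) ∷ []) ∷ (differ ∷ []) ∷ [] ∷ []
      among : C t ∈ C r ∷ C (nbr₁ r) ∷ C (nbr₂ r) ∷ [] → t ≡ r ⊎ r ~ t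
      among (here e)                 = inj₁ (sym (t-single r (sym e)))
      among (there (here e))         = inj₂ (subst (r ~_) (t-single _ (sym e)) (~nbr₁ r))
      among (there (there (here e))) = inj₂ (subst (r ~_) (t-single _ (sym e)) (~nbr₂ r))

    singleton-spreads : ∀ {t r} → Singleton t → r ≢ t → ¬ t ~ r → Singleton r
    singleton-spreads {t} {r} t-single r≢t t≁r with C (nbr₁ r) ≟ C (nbr₂ r)
    ... | yes same   = equal-neighbours⇒singleton (n<1+n 2) (~nbr₁ r) (~nbr₂ r) (nbr₁≢nbr₂ r) same
    ... | no  differ =
      ⊥-elim ([ r≢t ∘ sym , t≁r ∘ ~-sym ] (singleton-near-rainbow differ t-single))

    -- Two vertices outside the closed neighbourhood of a singleton t are singletons too, so the three
    -- colors are all taken by singletons.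
    no-singleton : 4 < n G → ∀ {u w} → u ≢ w → C u ≡ C w → ∀ t → ¬ Singleton t
    no-singleton 4<n {u} {w} u≢w Cu≡Cw t t-single
      with r₁ , r₁∉ ← fresh (<⇒≤ 4<n) (t ∷ nbr₁ t ∷ nbr₂ t ∷ [])
      with r₂ , r₂∉ ← fresh 4<n (t ∷ nbr₁ t ∷ nbr₂ t ∷ r₁ ∷ []) = among (unique⇒∈ singletons-rainbow (C w))
      where
      r₁-single : Singleton r₁
      r₁-single = singleton-spreads t-single (r₁∉ ∘ here) (non-nbr⇒≁ (r₁∉ ∘ there ∘ here) (r₁∉ ∘ there ∘ there ∘ here))
      r₂-single : Singleton r₂
      r₂-single = singleton-spreads t-single (r₂∉ ∘ here) (non-nbr⇒≁ (r₂∉ ∘ there ∘ here) (r₂∉ ∘ there ∘ there ∘ here))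
      singletons-rainbow : Unique (C t ∷ C r₁ ∷ C r₂ ∷ [])
      singletons-rainbow = ((λ e → r₁∉ (here (t-single r₁ (sym e)))) ∷ (λ e → r₂∉ (here (t-single r₂ (sym e)))) ∷ [])
                         ∷ ((λ e → r₂∉ (there (there (there (here (r₁-single r₂ (sym e))))))) ∷ []) ∷ [] ∷ []
      among : C w ∈ C t ∷ C r₁ ∷ C r₂ ∷ [] → ⊥
      among (here e)                 = classmates-not-singleton u≢w Cu≡Cw t-single e
      among (there (here e))         = classmates-not-singleton u≢w Cu≡Cw r₁-single e
      among (there (there (here e))) = classmates-not-singleton u≢w Cu≡Cw r₂-single e

    no-classmates : 4 < n G → ∀ {u w} → u ≢ w → C u ≡ C w → ⊥
    no-classmates 4<n {u} {w} u≢w Cu≡Cw = placement (on-cycle? u)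
      where
      open Walk (~nbr₁ w)

      neighbours-differ : ∀ t → C (walk t) ≢ C (walk (2 + t))
      neighbours-differ t same = no-singleton 4<n u≢w Cu≡Cw (walk (suc t))
        (equal-neighbours⇒singleton (n<1+n 2) (~-sym (walk-~ t)) (walk-~ (suc t)) (walk-no-backtrack t ∘ sym) same)

      period : ∀ t → C (walk (3 + t)) ≡ C (walk t)
      period t = ∉tail⇒≡head distinct λ
        { (here e)         → neighbours-differ (suc t) (sym e)
        ; (there (here e)) → proper c _ _ (walk-~ (2 + t)) (sym e)
        ; (there (there ())) }
        where
        distinct : Unique (C (walk t) ∷ C (walk (1 + t)) ∷ C (walk (2 + t)) ∷ [])
        distinct = (proper c _ _ (walk-~ t) ∷ neighbours-differ t ∷ []) ∷ (proper c _ _ (walk-~ (suc t)) ∷ [])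
                 ∷ [] ∷ []

      len≡3 : len ≡ 3
      len≡3 = ≤-antisym (walk-len-minimal (s≤s z≤n) (color-period⇒walk-period {c = c} distinguishing 3 period)) 3≤len

      on-triangle : ∀ {i} → i < 3 → walk i ≢ u
      on-triangle {0} _ refl = u≢w refl
      on-triangle {1} _ refl = proper c _ _ (walk-~ 0) (sym Cu≡Cw)
      on-triangle {2} _ refl = neighbours-differ 0 (sym Cu≡Cw)
      on-triangle {suc (suc (suc _))} (s≤s (s≤s (s≤s ())))

      placement : Dec (OnCycle u) → ⊥
      placement (yes (i , i<len , walk-i≡u)) = on-triangle (subst (i <_) len≡3 i<len) walk-i≡u
      placement (no  off) = proper c w (walk 1) (walk-~ 0) (begin
        C w                         ≡⟨ Cu≡Cw ⟨
        C u                         ≡⟨ cong C (rotation^-off off 1) ⟨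
        C (apply (rotation ^ 1) u)  ≡⟨ automorphism-preserves-classes (rotation ^ 1) Cu≡Cw ⟩
        C (apply (rotation ^ 1) w)  ≡⟨ cong C (rotation^-walk 1 0) ⟩
        C (walk 1)                  ∎)

  χD<order : 4 < n G → ∀ {k} → IsChiD G k → k < n G
  χD<order 4<n (_ , least) =
    subst (_ <_) (sym n≡suc-pred) (s≤s (least (pred (n G)) (smaller-distinguishing-coloring n≡suc-pred 4<n)))
    where
    n≡suc-pred : n G ≡ suc (pred (n G))
    n≡suc-pred = sym (suc-pred (n G) {{>-nonZero (≤-trans (s≤s z≤n) 4<n)}})

  classmates-impossible : 4 < n G → ∀ k (c : Coloring G k) → Distinguishing c → UniqueDistPartition G k →
                          ∀ {u w} → u ≢ w → col c u ≡ col c w → ⊥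
  classmates-impossible _   0 c _ _ {u} _ _ with () ← col c u
  classmates-impossible _   1 c _ _ {u} _ _ = proper c u (nbr₁ u) (~nbr₁ u) (∉tail⇒≡head ([] ∷ []) λ ())
  classmates-impossible _   2 c distinguishing _ _ _ = no-distinguishing-2-coloring c distinguishing
  classmates-impossible 4<n 3 c distinguishing unique = ThreeColored.no-classmates c distinguishing unique 4<n
  classmates-impossible _   (suc (suc (suc (suc k)))) c distinguishing unique {u} {w} u≢w Cu≡Cw =
    u≢w (≥4-colors⇒singleton (s≤s (s≤s (s≤s (s≤s z≤n)))) w u Cu≡Cw)
    where open UniquelyColored c distinguishing unique

  large⇒not-UDC : 4 < n G → ¬ UniquelyDistColorable G
  large⇒not-UDC 4<n (k , χD@((c , distinguishing) , _) , unique) =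
    repeated-color (pigeonhole (χD<order 4<n χD) (col c))
    where
    repeated-color : (∃₂ λ u w → u Fin.< w × col c u ≡ col c w) → ⊥
    repeated-color (u , w , u<w , Cu≡Cw) = classmates-impossible 4<n k c distinguishing unique (<⇒≢ u<w) Cu≡Cw

triangle : (G : Graph) → n G ≡ 3 → IsSimple G → Regular 2 G → G ≅ Cycle 3
triangle G refl simple regular = ≅-via-from ↔-refl adjacency
  where
  open TwoRegular simple regular

  ≢⇒~ : ∀ {i j} → i ≢ j → i ~ j
  ≢⇒~ {i} {j} i≢j with unique⇒∈ (closed-nbhd-distinct i) j
  ... | here j≡i                = ⊥-elim (i≢j (sym j≡i))
  ... | there (here refl)         = ~nbr₁ i
  ... | there (there (here refl)) = ~nbr₂ i

  adjacency : ∀ i j → Adj (Cycle 3) i j ≡ Adj G i j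
  adjacency zero             zero             = sym (loopless simple _)
  adjacency zero             (suc zero)       = sym (≢⇒~ λ ())
  adjacency zero             (suc (suc zero)) = sym (≢⇒~ λ ())
  adjacency (suc zero)       zero             = sym (≢⇒~ λ ())
  adjacency (suc zero)       (suc zero)       = sym (loopless simple _)
  adjacency (suc zero)       (suc (suc zero)) = sym (≢⇒~ λ ())
  adjacency (suc (suc zero)) zero             = sym (≢⇒~ λ ())
  adjacency (suc (suc zero)) (suc zero)       = sym (≢⇒~ λ ())
  adjacency (suc (suc zero)) (suc (suc zero)) = sym (loopless simple _)

-- With a, b the neighbours of 0 and d the fourth vertex, the cycle is 0 a d b.
square : (G : Graph) → n G ≡ 4 → IsSimple G → Regular 2 G → G ≅ Cycle 4
square G refl simple regular
  with d , d∉ ← fresh (n<1+n 3) (zero ∷ TwoRegular.nbr₁ simple regular zero ∷ TwoRegular.nbr₂ simple regular zero ∷ [])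
     = ≅-via-from (enumeration↔ distinct) adjacency
  where
  open TwoRegular simple regular

  a b : V
  a = nbr₁ zero
  b = nbr₂ zero

  0≁d : ¬ zero ~ d
  0≁d = non-nbr⇒≁ (d∉ ∘ there ∘ here) (d∉ ∘ there ∘ there ∘ here)

  distinct : Unique (zero ∷ a ∷ d ∷ b ∷ [])
  distinct = (~⇒≢ (~nbr₁ zero) ∷ (d∉ ∘ here ∘ sym) ∷ ~⇒≢ (~nbr₂ zero) ∷ [])
           ∷ ((d∉ ∘ there ∘ here ∘ sym) ∷ nbr₁≢nbr₂ zero ∷ [])
           ∷ ((d∉ ∘ there ∘ there ∘ here) ∷ [])
           ∷ [] ∷ []

  d-nbrs : ∀ {r} → d ~ r → r ≡ a ⊎ r ≡ b
  d-nbrs {r} d~r with unique⇒∈ distinct r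
  ... | here refl                         = ⊥-elim (0≁d (~-sym d~r))
  ... | there (here r≡a)                  = inj₁ r≡a
  ... | there (there (here refl))         = ⊥-elim (~⇒≢ d~r refl)
  ... | there (there (there (here r≡b))) = inj₂ r≡b

  d~a : d ~ a
  d~a with d-nbrs (~nbr₁ d) | d-nbrs (~nbr₂ d)
  ... | inj₁ e | _      = subst (d ~_) e (~nbr₁ d)
  ... | _      | inj₁ e = subst (d ~_) e (~nbr₂ d)
  ... | inj₂ e | inj₂ e′ = ⊥-elim (nbr₁≢nbr₂ d (trans e (sym e′)))

  d~b : d ~ b
  d~b with d-nbrs (~nbr₁ d) | d-nbrs (~nbr₂ d)
  ... | inj₂ e | _      = subst (d ~_) e (~nbr₁ d)
  ... | _      | inj₂ e = subst (d ~_) e (~nbr₂ d)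
  ... | inj₁ e | inj₁ e′ = ⊥-elim (nbr₁≢nbr₂ d (trans e (sym e′)))

  a≁b : ¬ a ~ b
  a≁b a~b with two-neighbours (~-sym (~nbr₂ zero)) (~-sym d~b) (d∉ ∘ here ∘ sym) (~-sym a~b)
  ... | inj₁ a≡0 = ~⇒≢ (~nbr₁ zero) (sym a≡0)
  ... | inj₂ a≡d = d∉ (there (here (sym a≡d)))

  adjacency : ∀ i j → Adj (Cycle 4) i j ≡ Adj G (lookup (zero ∷ a ∷ d ∷ b ∷ []) i) (lookup (zero ∷ a ∷ d ∷ b ∷ []) j)
  adjacency zero                   zero                   = sym (loopless simple _)
  adjacency zero                   (suc zero)             = sym (~nbr₁ zero)
  adjacency zero                   (suc (suc zero))       = sym (≁⇒false 0≁d)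
  adjacency zero                   (suc (suc (suc zero))) = sym (~nbr₂ zero)
  adjacency (suc zero)             zero                   = sym (~-sym (~nbr₁ zero))
  adjacency (suc zero)             (suc zero)             = sym (loopless simple _)
  adjacency (suc zero)             (suc (suc zero))       = sym (~-sym d~a)
  adjacency (suc zero)             (suc (suc (suc zero))) = sym (≁⇒false a≁b)
  adjacency (suc (suc zero))       zero                   = sym (≁⇒false (0≁d ∘ ~-sym))
  adjacency (suc (suc zero))       (suc zero)             = sym d~a
  adjacency (suc (suc zero))       (suc (suc zero))       = sym (loopless simple _)
  adjacency (suc (suc zero))       (suc (suc (suc zero))) = sym d~b
  adjacency (suc (suc (suc zero))) zero                   = sym (~-sym (~nbr₂ zero))
  adjacency (suc (suc (suc zero))) (suc zero)             = sym (≁⇒false (a≁b ∘ ~-sym))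
  adjacency (suc (suc (suc zero))) (suc (suc zero))       = sym (~-sym d~b)
  adjacency (suc (suc (suc zero))) (suc (suc (suc zero))) = sym (loopless simple _)

corollary3p7 : (G : Graph) → IsSimple G → n G ≥ 1 → UniquelyDistColorable G → Regular 2 G
    → (G ≅ Cycle 3) ⊎ (G ≅ Cycle 4)
corollary3p7 G simple n≥1 udc regular = by-order (n G) refl (TwoRegular.3≤order simple regular (fromℕ< n≥1))
  where
  by-order : ∀ m → n G ≡ m → 3 ≤ m → (G ≅ Cycle 3) ⊎ (G ≅ Cycle 4)
  by-order 1 _ (s≤s ())
  by-order 2 _ (s≤s (s≤s ()))
  by-order 3 order _ = inj₁ (triangle G order simple regular)
  by-order 4 order _ = inj₂ (square G order simple regular)
  by-order (suc (suc (suc (suc (suc m))))) order _ =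
    ⊥-elim (TwoRegularColorings.large⇒not-UDC simple regular (subst (4 <_) (sym order) (s≤s (s≤s (s≤s (s≤s (s≤s z≤n)))))) udc)
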